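{- Let $G$ be a finite group, let $S$ be a subset of $G$ with $1\notin S$, and let $H,K$ be subgroups of $G$ with $1<H\leq K<G$ and $H\trianglelefteq G$. Assume that $S\setminus K$ is a union of some cosets of $H$ in $G$, and that there exist $x\in G\setminus K$ and $y\in H$ such that $x^{ -1}yx\neq y^{ -1}$. Then the Cayley digraph $\mathrm{Cay}(G,S)$ is not normal.
   Context: For a group $G$ and a subset $S\subseteq G$ with $1\notin S$, the Cayley digraph $\mathrm{Cay}(G,S)$ has vertex set $G$ and arc set $\{(g,sg)\mid g\in G, s\in S\}$. The right regular representation is $R(G)=\{R(g)\mid g\in G\}$, where $x^{R(g)}=xg$; it is a subgroup of $\mathrm{Aut}(\mathrm{Cay}(G,S))$. $\mathrm{Cay}(G,S)$ is called normal if $R(G)$ is a normal subgroup of $\mathrm{Aut}(\mathrm{Cay}(G,S))$. -}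

module Defs where

open import Level using (0ℓ)
open import Data.Nat using (ℕ)
open import Data.Fin using (Fin)
open import Data.Fin.Permutation using (Permutation′; _⟨$⟩ʳ_; _⟨$⟩ˡ_)
open import Data.Product using (Σ; ∃; _×_; _,_)
open import Relation.Unary using (Pred; _∈_; _∉_; _⊆_)
open import Relation.Nullary using (¬_)
open import Relation.Binary.PropositionalEquality using (_≡_)
open import Algebra.Core using (Op₁; Op₂)
open import Algebra.Structures using (IsGroup)
open import Function.Bundles using (_⇔_)

record FinGroup : Set where
  field
    n       : ℕ
    _∙_     : Op₂ (Fin n)
    ε       : Fin n
    _⁻¹     : Op₁ (Fin n)
    isGroup : IsGroup _≡_ _∙_ ε _⁻¹
  infixl 7 _∙_
  infix 8 _⁻¹

  Elt : Set
  Elt = Fin n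

  SubsetG : Set₁
  SubsetG = Pred Elt 0ℓ

  IsSubgroup : SubsetG → Set
  IsSubgroup H = (ε ∈ H)
               × (∀ {a b} → a ∈ H → b ∈ H → (a ∙ b) ∈ H)
               × (∀ {a} → a ∈ H → (a ⁻¹) ∈ H)

  IsNormalSubset : SubsetG → Set
  IsNormalSubset H = ∀ g h → h ∈ H → (g ⁻¹ ∙ h ∙ g) ∈ H

  Nontrivial : SubsetG → Set
  Nontrivial H = ∃ λ h → h ∈ H × ¬ (h ≡ ε)

  Proper : SubsetG → Set
  Proper K = ∃ λ g → g ∉ K

  _∖_ : SubsetG → SubsetG → SubsetG
  (S ∖ K) g = g ∈ S × g ∉ K

  -- T is a union of some (right) cosets Hr of H in G:
  -- there is a set R of representatives with T = ⋃_{r ∈ R} H r.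
  -- (For normal H left and right cosets coincide.)
  IsUnionOfCosets : SubsetG → SubsetG → Set₁
  IsUnionOfCosets H T =
    Σ SubsetG λ R → ∀ g → (g ∈ T) ⇔ (∃ λ r → r ∈ R × ∃ λ h → h ∈ H × g ≡ h ∙ r)

  Arc : SubsetG → Elt → Elt → Set
  Arc S g g′ = ∃ λ s → s ∈ S × g′ ≡ s ∙ g

  IsAut : SubsetG → Permutation′ n → Set
  IsAut S σ = ∀ g g′ → Arc S g g′ ⇔ Arc S (σ ⟨$⟩ʳ g) (σ ⟨$⟩ʳ g′)

  R : Elt → Elt → Elt
  R g x = x ∙ g

  -- Cay(G,S) is normal: R(G) is normal in Aut(Cay(G,S)), i.e. for every
  -- automorphism σ and g ∈ G, the conjugate σ⁻¹ R(g) σ (x ↦ σ(σ⁻¹(x) g))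
  -- equals R(g′) for some g′ ∈ G.
  IsNormalCayley : SubsetG → Set
  IsNormalCayley S =
    ∀ (σ : Permutation′ n) → IsAut S σ →
      ∀ g → ∃ λ g′ → ∀ x → σ ⟨$⟩ʳ (R g (σ ⟨$⟩ˡ x)) ≡ R g′ x

-- Right multiplication by y on the right coset Kx,
-- and the identity elsewhere, is an automorphism of Cay(G,S): an arc g → g′ exists iff
-- g′ g⁻¹ ∈ S, and this quotient is unchanged inside a K-coset, while across K-cosets it
-- lies outside K and changes only by a factor in H, under which S ∖ K is invariant.
-- If its conjugate of R(x) were some R(g′), evaluating at 1 gives g′ = x y, and then
-- evaluating at x⁻¹ forces x⁻¹ y x = y⁻¹.
module Submission where

open import Defs
open import Level using (0ℓ)
open import Algebra.Bundles using (Group)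
open import Algebra.Structures using (IsGroup)
import Algebra.Properties.Group as GroupProperties
open import Data.Nat using (zero; suc)
open import Data.Fin using (Fin; zero; suc)
open import Data.Fin.Permutation using (Permutation′; permutation)
open import Data.Product using (∃; _×_; _,_; proj₁; proj₂)
open import Function.Base using (_∘_)
open import Function.Bundles using (_⇔_; mk⇔; Equivalence)
import Function.Properties.Equivalence as ⇔
open import Relation.Unary using (Pred; Decidable; _∈_; _∉_; _⊆_)
open import Relation.Nullary using (¬_; Dec; yes; no)
open import Relation.Nullary.Negation using (DoubleNegation; contradiction)
open import Relation.Nullary.Decidable using (¬¬-excluded-middle)
open import Relation.Binary.PropositionalEquality
  using (_≡_; refl; sym; trans; cong; subst; module ≡-Reasoning)

¬¬-decidable : ∀ {n} (P : Pred (Fin n) 0ℓ) → DoubleNegation (Decidable P)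
¬¬-decidable {zero}  P ¬P? = ¬P? λ ()
¬¬-decidable {suc n} P ¬P? =
  ¬¬-excluded-middle λ P0? → ¬¬-decidable (P ∘ suc) λ P? →
    ¬P? λ { zero → P0? ; (suc i) → P? i }

module Cayley (G : FinGroup) where
  open FinGroup G
  open IsGroup isGroup using (assoc; identityˡ; identityʳ; inverseˡ; inverseʳ)
  open ≡-Reasoning

  group : Group 0ℓ 0ℓ
  group = record { isGroup = isGroup }

  open GroupProperties group
    using (⁻¹-involutive; ⁻¹-anti-homo-∙; ε⁻¹≈ε;
           \\-leftDividesˡ; \\-leftDividesʳ; //-rightDividesˡ; //-rightDividesʳ)

  ⁻¹-∙-cancelʳ : ∀ a b c → (b ∙ c) ∙ (a ∙ c) ⁻¹ ≡ b ∙ a ⁻¹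
  ⁻¹-∙-cancelʳ a b c = begin
    b ∙ c ∙ (a ∙ c) ⁻¹      ≡⟨ cong (b ∙ c ∙_) (⁻¹-anti-homo-∙ a c) ⟩
    b ∙ c ∙ (c ⁻¹ ∙ a ⁻¹)   ≡⟨ assoc b c _ ⟩
    b ∙ (c ∙ (c ⁻¹ ∙ a ⁻¹)) ≡⟨ cong (b ∙_) (\\-leftDividesˡ c (a ⁻¹)) ⟩
    b ∙ a ⁻¹                 ∎

  ⁻¹-∙-conjugate : ∀ a b ca cb →
    (b ∙ cb) ∙ (a ∙ ca) ⁻¹ ≡ (b ∙ a ⁻¹) ∙ (a ∙ (cb ∙ ca ⁻¹) ∙ a ⁻¹)
  ⁻¹-∙-conjugate a b ca cb = begin
    b ∙ cb ∙ (a ∙ ca) ⁻¹         ≡⟨ cong (b ∙ cb ∙_) (⁻¹-anti-homo-∙ a ca) ⟩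
    b ∙ cb ∙ (ca ⁻¹ ∙ a ⁻¹)      ≡⟨ assoc (b ∙ cb) (ca ⁻¹) (a ⁻¹) ⟨
    b ∙ cb ∙ ca ⁻¹ ∙ a ⁻¹        ≡⟨ cong (_∙ a ⁻¹) (assoc b cb (ca ⁻¹)) ⟩
    b ∙ q ∙ a ⁻¹                 ≡⟨ cong (λ z → z ∙ q ∙ a ⁻¹) (//-rightDividesˡ a b) ⟨
    b ∙ a ⁻¹ ∙ a ∙ q ∙ a ⁻¹      ≡⟨ cong (_∙ a ⁻¹) (assoc (b ∙ a ⁻¹) a q) ⟩
    b ∙ a ⁻¹ ∙ (a ∙ q) ∙ a ⁻¹    ≡⟨ assoc (b ∙ a ⁻¹) (a ∙ q) (a ⁻¹) ⟩
    b ∙ a ⁻¹ ∙ (a ∙ q ∙ a ⁻¹)    ∎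
    where q = cb ∙ ca ⁻¹

  conjugate-⁻¹ : ∀ a b → (a ⁻¹ ∙ b ∙ a) ⁻¹ ≡ a ⁻¹ ∙ b ⁻¹ ∙ a
  conjugate-⁻¹ a b = begin
    (a ⁻¹ ∙ b ∙ a) ⁻¹          ≡⟨ ⁻¹-anti-homo-∙ (a ⁻¹ ∙ b) a ⟩
    a ⁻¹ ∙ (a ⁻¹ ∙ b) ⁻¹       ≡⟨ cong (a ⁻¹ ∙_) (⁻¹-anti-homo-∙ (a ⁻¹) b) ⟩
    a ⁻¹ ∙ (b ⁻¹ ∙ a ⁻¹ ⁻¹)    ≡⟨ cong (λ z → a ⁻¹ ∙ (b ⁻¹ ∙ z)) (⁻¹-involutive a) ⟩
    a ⁻¹ ∙ (b ⁻¹ ∙ a)          ≡⟨ assoc (a ⁻¹) (b ⁻¹) a ⟨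
    a ⁻¹ ∙ b ⁻¹ ∙ a            ∎

  Arc⇔quotient∈ : ∀ S a b → Arc S a b ⇔ (b ∙ a ⁻¹ ∈ S)
  Arc⇔quotient∈ S a b = mk⇔
    (λ { (s , s∈S , refl) → subst (_∈ S) (sym (//-rightDividesʳ a s)) s∈S })
    (λ b∙a⁻¹∈S → b ∙ a ⁻¹ , b∙a⁻¹∈S , sym (//-rightDividesˡ a b))

  module Subgroup {K : SubsetG} (K≤G : IsSubgroup K) where

    ∙-closed : ∀ {a b} → a ∈ K → b ∈ K → a ∙ b ∈ K
    ∙-closed = proj₁ (proj₂ K≤G)

    ⁻¹-closed : ∀ {a} → a ∈ K → a ⁻¹ ∈ K
    ⁻¹-closed = proj₂ (proj₂ K≤G)

    ∉-⁻¹ : ∀ {a} → a ∉ K → a ⁻¹ ∉ K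
    ∉-⁻¹ {a} a∉K a⁻¹∈K = a∉K (subst (_∈ K) (⁻¹-involutive a) (⁻¹-closed a⁻¹∈K))

    ∉-∙-∈ : ∀ {a b} → a ∉ K → b ∈ K → a ∙ b ∉ K
    ∉-∙-∈ {a} {b} a∉K b∈K a∙b∈K =
      a∉K (subst (_∈ K) (//-rightDividesʳ b a) (∙-closed a∙b∈K (⁻¹-closed b∈K)))

    quotient∈-sym : ∀ {a b} → b ∙ a ⁻¹ ∈ K → a ∙ b ⁻¹ ∈ K
    quotient∈-sym {a} {b} b∙a⁻¹∈K = subst (_∈ K) eq (⁻¹-closed b∙a⁻¹∈K)
      where
      eq : (b ∙ a ⁻¹) ⁻¹ ≡ a ∙ b ⁻¹
      eq = trans (⁻¹-anti-homo-∙ b (a ⁻¹)) (cong (_∙ b ⁻¹) (⁻¹-involutive a))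

    quotient∈-trans : ∀ {a b c} → b ∙ a ⁻¹ ∈ K → a ∙ c ⁻¹ ∈ K → b ∙ c ⁻¹ ∈ K
    quotient∈-trans {a} {b} {c} b∙a⁻¹∈K a∙c⁻¹∈K = subst (_∈ K) eq (∙-closed b∙a⁻¹∈K a∙c⁻¹∈K)
      where
      eq : b ∙ a ⁻¹ ∙ (a ∙ c ⁻¹) ≡ b ∙ c ⁻¹
      eq = trans (assoc b (a ⁻¹) _) (cong (b ∙_) (\\-leftDividesʳ a (c ⁻¹)))

  conjugate∈ : {H : SubsetG} → IsNormalSubset H → ∀ a {c} → c ∈ H → a ∙ c ∙ a ⁻¹ ∈ H
  conjugate∈ {H} H⊴G a {c} c∈H =
    subst (λ z → z ∙ c ∙ a ⁻¹ ∈ H) (⁻¹-involutive a) (H⊴G (a ⁻¹) c c∈H)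

  module CosetUnion {H T : SubsetG} (H≤G : IsSubgroup H) (H⊴G : IsNormalSubset H)
                    (T-union : IsUnionOfCosets H T) where

    ∙ˡ-closed : ∀ {c t} → c ∈ H → t ∈ T → c ∙ t ∈ T
    ∙ˡ-closed {c} {t} c∈H t∈T with Equivalence.to (proj₂ T-union t) t∈T
    ... | r , r∈R , d , d∈H , refl =
      Equivalence.from (proj₂ T-union (c ∙ (d ∙ r)))
        (r , r∈R , c ∙ d , Subgroup.∙-closed H≤G c∈H d∈H , sym (assoc c d r))

    ∙ʳ-closed : ∀ {c t} → c ∈ H → t ∈ T → t ∙ c ∈ T
    ∙ʳ-closed {c} {t} c∈H t∈T =
      subst (_∈ T) (//-rightDividesˡ t (t ∙ c)) (∙ˡ-closed (conjugate∈ H⊴G t c∈H) t∈T)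

    ∙ʳ-invariant : ∀ {c t} → c ∈ H → t ∈ T ⇔ t ∙ c ∈ T
    ∙ʳ-invariant {c} {t} c∈H = mk⇔ (∙ʳ-closed c∈H)
      (λ t∙c∈T → subst (_∈ T) (//-rightDividesʳ c t) (∙ʳ-closed (Subgroup.⁻¹-closed H≤G c∈H) t∙c∈T))

  module Automorphism {S H K : SubsetG} (H≤G : IsSubgroup H) (K≤G : IsSubgroup K)
    (H⊆K : H ⊆ K) (H⊴G : IsNormalSubset H) (S∖K-union : IsUnionOfCosets H (S ∖ K))
    (K? : Decidable K) where

    open Subgroup

    ∈S⇔∈S∖K : ∀ {t} → t ∉ K → t ∈ S ⇔ t ∈ S ∖ K
    ∈S⇔∈S∖K t∉K = mk⇔ (_, t∉K) proj₁

    quotient∈S-invariant : ∀ {a b ca cb} → b ∙ a ⁻¹ ∉ K → ca ∈ H → cb ∈ H →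
      b ∙ a ⁻¹ ∈ S ⇔ (b ∙ cb) ∙ (a ∙ ca) ⁻¹ ∈ S
    quotient∈S-invariant {a} {b} {ca} {cb} q∉K ca∈H cb∈H =
      subst (λ z → b ∙ a ⁻¹ ∈ S ⇔ z ∈ S) (sym (⁻¹-∙-conjugate a b ca cb))
        (⇔.trans (∈S⇔∈S∖K q∉K)
        (⇔.trans (CosetUnion.∙ʳ-invariant H≤G H⊴G S∖K-union d∈H)
                 (⇔.sym (∈S⇔∈S∖K (∉-∙-∈ K≤G q∉K (H⊆K d∈H))))))
      where
      d∈H : a ∙ (cb ∙ ca ⁻¹) ∙ a ⁻¹ ∈ H
      d∈H = conjugate∈ H⊴G a (∙-closed H≤G cb∈H (⁻¹-closed H≤G ca∈H))

    module CosetwiseTranslation (c : Elt → Elt) (c∈H : ∀ g → c g ∈ H)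
      (c-const : ∀ {a b} → b ∙ a ⁻¹ ∈ K → c a ≡ c b) where

      translate : Elt → Elt
      translate g = g ∙ c g

      untranslate : Elt → Elt
      untranslate g = g ∙ c g ⁻¹

      c-translate : ∀ g → c (translate g) ≡ c g
      c-translate g = sym (c-const (H⊆K (conjugate∈ H⊴G g (c∈H g))))

      c-untranslate : ∀ g → c (untranslate g) ≡ c g
      c-untranslate g = sym (c-const (H⊆K (conjugate∈ H⊴G g (⁻¹-closed H≤G (c∈H g)))))

      translate∘untranslate : ∀ g → translate (untranslate g) ≡ g
      translate∘untranslate g = begin
        g ∙ c g ⁻¹ ∙ c (untranslate g) ≡⟨ cong (g ∙ c g ⁻¹ ∙_) (c-untranslate g) ⟩
        g ∙ c g ⁻¹ ∙ c g               ≡⟨ //-rightDividesˡ (c g) g ⟩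
        g                              ∎

      untranslate∘translate : ∀ g → untranslate (translate g) ≡ g
      untranslate∘translate g = begin
        g ∙ c g ∙ c (translate g) ⁻¹ ≡⟨ cong (λ z → g ∙ c g ∙ z ⁻¹) (c-translate g) ⟩
        g ∙ c g ∙ c g ⁻¹             ≡⟨ //-rightDividesʳ (c g) g ⟩
        g                            ∎

      σ : Permutation′ n
      σ = permutation translate untranslate translate∘untranslate untranslate∘translate

      quotient∈S⇔ : ∀ a b → b ∙ a ⁻¹ ∈ S ⇔ translate b ∙ translate a ⁻¹ ∈ S
      quotient∈S⇔ a b with K? (b ∙ a ⁻¹)
      ... | no  q∉K = quotient∈S-invariant q∉K (c∈H a) (c∈H b)
      ... | yes q∈K = subst (λ z → b ∙ a ⁻¹ ∈ S ⇔ z ∈ S) eq ⇔.refl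
        where
        eq : b ∙ a ⁻¹ ≡ translate b ∙ translate a ⁻¹
        eq = trans (sym (⁻¹-∙-cancelʳ a b (c a))) (cong (λ z → b ∙ z ∙ (a ∙ c a) ⁻¹) (c-const q∈K))

      σ-isAut : IsAut S σ
      σ-isAut a b = ⇔.trans (Arc⇔quotient∈ S a b)
        (⇔.trans (quotient∈S⇔ a b) (⇔.sym (Arc⇔quotient∈ S (translate a) (translate b))))

    module ShiftOnCoset (x h : Elt) (x∉K : x ∉ K) (h∈H : h ∈ H) where

      shift : Elt → Elt
      shift g with K? (g ∙ x ⁻¹)
      ... | yes _ = h
      ... | no  _ = ε

      shift∈H : ∀ g → shift g ∈ H
      shift∈H g with K? (g ∙ x ⁻¹)
      ... | yes _ = h∈H
      ... | no  _ = proj₁ H≤G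

      shift-const : ∀ {a b} → b ∙ a ⁻¹ ∈ K → shift a ≡ shift b
      shift-const {a} {b} q∈K with K? (a ∙ x ⁻¹) | K? (b ∙ x ⁻¹)
      ... | yes _   | yes _   = refl
      ... | no  _   | no  _   = refl
      ... | yes a∈Kx | no b∉Kx = contradiction (quotient∈-trans K≤G q∈K a∈Kx) b∉Kx
      ... | no a∉Kx | yes b∈Kx = contradiction (quotient∈-trans K≤G (quotient∈-sym K≤G q∈K) b∈Kx) a∉Kx

      shift-in : ∀ {g} → g ∙ x ⁻¹ ∈ K → shift g ≡ h
      shift-in {g} g∈Kx with K? (g ∙ x ⁻¹)
      ... | yes _     = refl
      ... | no g∉Kx = contradiction g∈Kx g∉Kx

      shift-out : ∀ {g} → g ∙ x ⁻¹ ∉ K → shift g ≡ ε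
      shift-out {g} g∉Kx with K? (g ∙ x ⁻¹)
      ... | yes g∈Kx = contradiction g∈Kx g∉Kx
      ... | no _      = refl

      open CosetwiseTranslation shift shift∈H shift-const

      translate-out : ∀ {g} → g ∙ x ⁻¹ ∉ K → translate g ≡ g
      translate-out {g} g∉Kx = trans (cong (g ∙_) (shift-out g∉Kx)) (identityʳ g)

      untranslate-out : ∀ {g} → g ∙ x ⁻¹ ∉ K → untranslate g ≡ g
      untranslate-out {g} g∉Kx =
        trans (cong (λ z → g ∙ z ⁻¹) (shift-out g∉Kx)) (trans (cong (g ∙_) ε⁻¹≈ε) (identityʳ g))

      x⁻¹∉K : x ⁻¹ ∉ K
      x⁻¹∉K = ∉-⁻¹ K≤G x∉K

      ε∉Kx : ε ∙ x ⁻¹ ∉ K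
      ε∉Kx = subst (_∉ K) (sym (identityˡ (x ⁻¹))) x⁻¹∉K

      maps-x⁻¹-to-h⇒conjugate-inverts : translate (untranslate (x ⁻¹) ∙ x) ≡ h → x ⁻¹ ∙ h ∙ x ≡ h ⁻¹
      maps-x⁻¹-to-h⇒conjugate-inverts image≡h = by-cases (K? (x ⁻¹ ∙ x ⁻¹))
        where
        by-cases : Dec (x ⁻¹ ∙ x ⁻¹ ∈ K) → x ⁻¹ ∙ h ∙ x ≡ h ⁻¹
        by-cases (yes x⁻¹∈Kx) = begin
          x ⁻¹ ∙ h ∙ x         ≡⟨ cong (λ z → x ⁻¹ ∙ z ∙ x) (⁻¹-involutive h) ⟨
          x ⁻¹ ∙ h ⁻¹ ⁻¹ ∙ x   ≡⟨ conjugate-⁻¹ x (h ⁻¹) ⟨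
          (x ⁻¹ ∙ h ⁻¹ ∙ x) ⁻¹ ≡⟨ cong _⁻¹ w≡h ⟩
          h ⁻¹                 ∎
          where
          w∉Kx : x ⁻¹ ∙ h ⁻¹ ∙ x ∙ x ⁻¹ ∉ K
          w∉Kx = subst (_∉ K) (sym (//-rightDividesʳ x (x ⁻¹ ∙ h ⁻¹)))
                   (∉-∙-∈ K≤G x⁻¹∉K (H⊆K (⁻¹-closed H≤G h∈H)))
          w≡h : x ⁻¹ ∙ h ⁻¹ ∙ x ≡ h
          w≡h = begin
            x ⁻¹ ∙ h ⁻¹ ∙ x                    ≡⟨ translate-out w∉Kx ⟨
            translate (x ⁻¹ ∙ h ⁻¹ ∙ x)        ≡⟨ cong (λ z → translate (x ⁻¹ ∙ z ⁻¹ ∙ x)) (shift-in x⁻¹∈Kx) ⟨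
            translate (untranslate (x ⁻¹) ∙ x) ≡⟨ image≡h ⟩
            h                                  ∎
        by-cases (no x⁻¹∉Kx) = subst (λ z → x ⁻¹ ∙ z ∙ x ≡ z ⁻¹) (sym h≡ε) x⁻¹∙ε∙x≡ε⁻¹
          where
          h≡ε : h ≡ ε
          h≡ε = begin
            h                                  ≡⟨ image≡h ⟨
            translate (untranslate (x ⁻¹) ∙ x) ≡⟨ cong (λ z → translate (z ∙ x)) (untranslate-out x⁻¹∉Kx) ⟩
            translate (x ⁻¹ ∙ x)               ≡⟨ cong translate (inverseˡ x) ⟩
            translate ε                        ≡⟨ translate-out ε∉Kx ⟩
            ε                                  ∎
          x⁻¹∙ε∙x≡ε⁻¹ : x ⁻¹ ∙ ε ∙ x ≡ ε ⁻¹
          x⁻¹∙ε∙x≡ε⁻¹ = trans (cong (_∙ x) (identityʳ (x ⁻¹))) (trans (inverseˡ x) (sym ε⁻¹≈ε))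

      σRₓσ⁻¹-maps-x⁻¹-to-h : ∀ {g′} → (∀ y → translate (untranslate y ∙ x) ≡ y ∙ g′) →
        translate (untranslate (x ⁻¹) ∙ x) ≡ h
      σRₓσ⁻¹-maps-x⁻¹-to-h {g′} σRₓσ⁻¹≡Rg′ = begin
        translate (untranslate (x ⁻¹) ∙ x) ≡⟨ σRₓσ⁻¹≡Rg′ (x ⁻¹) ⟩
        x ⁻¹ ∙ g′                          ≡⟨ cong (x ⁻¹ ∙_) g′≡x∙h ⟩
        x ⁻¹ ∙ (x ∙ h)                     ≡⟨ \\-leftDividesʳ x h ⟩
        h                                  ∎
        where
        x∈Kx : x ∙ x ⁻¹ ∈ K
        x∈Kx = subst (_∈ K) (sym (inverseʳ x)) (proj₁ K≤G)
        g′≡x∙h : g′ ≡ x ∙ h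
        g′≡x∙h = begin
          g′                            ≡⟨ identityˡ g′ ⟨
          ε ∙ g′                        ≡⟨ σRₓσ⁻¹≡Rg′ ε ⟨
          translate (untranslate ε ∙ x) ≡⟨ cong (λ z → translate (z ∙ x)) (untranslate-out ε∉Kx) ⟩
          translate (ε ∙ x)             ≡⟨ cong translate (identityˡ x) ⟩
          x ∙ shift x                   ≡⟨ cong (x ∙_) (shift-in x∈Kx) ⟩
          x ∙ h                         ∎

      isNormal⇒conjugate-inverts : IsNormalCayley S → x ⁻¹ ∙ h ∙ x ≡ h ⁻¹
      isNormal⇒conjugate-inverts isNormal =
        let g′ , σRₓσ⁻¹≡Rg′ = isNormal σ σ-isAut x
        in maps-x⁻¹-to-h⇒conjugate-inverts (σRₓσ⁻¹-maps-x⁻¹-to-h σRₓσ⁻¹≡Rg′)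

proposition2p6 : (G : FinGroup) → let open FinGroup G in
    (S H K : SubsetG) →
    ε ∉ S →
    IsSubgroup H → IsSubgroup K →
    Nontrivial H → H ⊆ K → Proper K → IsNormalSubset H →
    IsUnionOfCosets H (S ∖ K) →
    (∃ λ x → ∃ λ y → x ∉ K × y ∈ H × ¬ (x ⁻¹ ∙ y ∙ x ≡ y ⁻¹)) →
    ¬ IsNormalCayley S
proposition2p6 G S H K _ H≤G K≤G _ H⊆K _ H⊴G S∖K-union (x , y , x∉K , y∈H , x⁻¹yx≢y⁻¹) isNormal =
  ¬¬-decidable K λ K? →
    let open Cayley.Automorphism G H≤G K≤G H⊆K H⊴G S∖K-union K?
    in x⁻¹yx≢y⁻¹ (ShiftOnCoset.isNormal⇒conjugate-inverts x y x∉K y∈H isNormal)
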